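{- Let $G$ be cellularly embedded on an orientable surface $\Sigma$ with non-empty boundary, and let edge signatures $[e]\in(\mathbb{Z}_2)^\beta$ be defined from a system of dual arcs of a tree-coforest decomposition of $G$. Two even subgraphs $H$ and $H'$ of $G$ are $\mathbb{Z}_2$-homologous in $\Sigma$ if and only if $[H]=[H']$.
   Context: $\Sigma$ is a compact connected orientable surface of genus $g$ with $b\ge1$ boundary components $\delta_1,\dots,\delta_b$, and $\beta=2g+b-1$; $G$ is cellularly embedded (faces open disks, boundary components traced by cycles of edges). The dual graph $G^*$ has a vertex for each face of $G$ and a dual boundary vertex $\delta_i^*$ for each boundary cycle, and an edge $e^*$ for each edge $e$ joining the duals of the faces/boundary cycles on its two sides. A tree-coforest decomposition is a partition $(T,L,F)$ of the edges such that $T$ is a spanning tree of $G$, $F^*$ is a spanning forest of $G^*$ each of whose components contains exactly one dual boundary vertex, and $L$ is the set of remaining edges; $|L|=\beta$, say $L=\{e_1,\dots,e_\beta\}$. For each $i$, $\alpha_i$ is the unique dual walk in $F^*\cup\{e_i^*\}$ between dual boundary vertices (possibly a loop from one back to itself) that uses $e_i^*$. The signature $[e]$ of an edge $e$ is the vector whose $i$th bit is $1$ iff $\alpha_i$ traverses $e^*$ an odd number of times; the signature $[H]$ of a subgraph is the bitwise XOR of the signatures of its edges. An even subgraph is a set of edges with every vertex of even degree; a boundary subgraph is the symmetric difference of boundary edge sets of a subset of faces of $G$; $H,H'$ are $\mathbb{Z}_2$-homologous if $H\oplus H'$ is a boundary subgraph. -}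

module Defs where

open import Data.Nat using (ℕ; zero; suc)
open import Data.Bool using (Bool; true; false; _xor_; _∧_; not; if_then_else_)
open import Data.Fin using (Fin; zero; suc; _≟_)
open import Data.Product using (_×_; _,_; proj₁; proj₂; ∃; ∃-syntax; Σ)
open import Data.Sum using (_⊎_)
open import Data.List using (List; []; _∷_; map; length; filter)
open import Data.List.Relation.Unary.All using (All)
open import Data.List.Relation.Unary.Unique.Propositional using (Unique)
open import Data.Vec using (Vec; tabulate; zipWith; replicate)
open import Relation.Nullary using (¬_)
open import Relation.Nullary.Decidable using (⌊_⌋)
open import Relation.Binary.PropositionalEquality using (_≡_; _≢_)
open import Data.Empty using (⊥)

iter : {A : Set} → (A → A) → ℕ → A → A
iter f zero    x = x
iter f (suc k) x = f (iter f k x)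

parity : ∀ {k} → (Fin k → Bool) → Bool
parity {zero}  p = false
parity {suc k} p = p zero xor parity (λ i → p (suc i))

oddℕ : ℕ → Bool
oddℕ zero    = false
oddℕ (suc n) = not (oddℕ n)

_==_ : ∀ {k} → Fin k → Fin k → Bool
x == y = ⌊ x ≟ y ⌋

⊕-sum : ∀ {k β} → (Fin k → Vec Bool β) → Vec Bool β
⊕-sum {zero}  v = replicate _ false
⊕-sum {suc k} v = zipWith _xor_ (v zero) (⊕-sum (λ i → v (suc i)))

data Walk {D V : Set} (s t : D → V) : V → V → List D → Set where
  []   : ∀ {x} → Walk s t x x []
  step : ∀ {y ds} (d : D) → Walk s t (t d) y ds → Walk s t (s d) y (d ∷ ds)

-- Cellularly embedded graphs on an orientable surface with boundary,
-- via rotation systems (combinatorial maps).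
-- Vertices Fin n, edges Fin m; each edge e has two darts (e , true) and
-- (e , false); (e , true) leaves proj₁ (ends e), (e , false) leaves proj₂ (ends e).
-- σ is the rotation system; faces are the orbits of φ = σ ∘ rev, labelled by
-- Fin f.  The faces with hole ≡ true are removed (boundary components δᵢ);
-- the remaining ones are the faces of G in Σ.

Dart : ℕ → Set
Dart m = Fin m × Bool

rev : ∀ {m} → Dart m → Dart m
rev (e , b) = (e , not b)

record Map : Set where
  field
    n m f : ℕ
    ends  : Fin m → Fin n × Fin n
    σ     : Dart m → Dart m
    face  : Dart m → Fin f
    hole  : Fin f → Bool

module MapOps (M : Map) where
  open Map M public

  tail : Dart m → Fin n
  tail (e , true)  = proj₁ (ends e)
  tail (e , false) = proj₂ (ends e)

  head : Dart m → Fin n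
  head d = tail (rev d)

  φ : Dart m → Dart m
  φ d = σ (rev d)

  -- dual graph G*: vertices Fin f (faces and dual boundary vertices δᵢ*);
  -- the dual dart of d joins the face on the side of d to the face on the
  -- side of rev d.
  dtail : Dart m → Fin f
  dtail d = face d

  dhead : Dart m → Fin f
  dhead d = face (rev d)

  ∂face : Fin f → Fin m → Bool
  ∂face x e = (face (e , true) == x) xor (face (e , false) == x)

  -- even subgraph: every vertex has even degree (a loop counts twice)
  Even : (Fin m → Bool) → Set
  Even H = ∀ v → parity (λ e → H e ∧ ((tail (e , true) == v) xor (tail (e , false) == v))) ≡ false

  ∂sub : (Fin f → Bool) → Fin m → Bool
  ∂sub S e = parity (λ x → S x ∧ ∂face x e)

  Homologous : (Fin m → Bool) → (Fin m → Bool) → Set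
  Homologous H H' = ∃[ S ] ((∀ x → hole x ≡ true → S x ≡ false) ×
                            (∀ e → (H e xor H' e) ≡ ∂sub S e))

  AcyclicG : (Fin m → Set) → Set
  AcyclicG P = ∀ v ds → Walk tail head v v ds → ds ≢ [] →
               All (λ d → P (proj₁ d)) ds → Unique (map proj₁ ds) → ⊥

  AcyclicG* : (Fin m → Set) → Set
  AcyclicG* P = ∀ x ds → Walk dtail dhead x x ds → ds ≢ [] →
                All (λ d → P (proj₁ d)) ds → Unique (map proj₁ ds) → ⊥

record IsEmbedded (M : Map) : Set where
  open MapOps M
  field
    σ-tail   : ∀ d → tail (σ d) ≡ tail d
    σ-orbit  : ∀ d d' → tail d ≡ tail d' → ∃[ k ] iter σ k d ≡ d'
    face-φ   : ∀ d → face (φ d) ≡ face d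
    face-orb : ∀ d d' → face d ≡ face d' → ∃[ k ] iter φ k d ≡ d'
    face-sur : ∀ x → ∃[ d ] face d ≡ x
    connected : ∀ v w → ∃[ ds ] Walk tail head v w ds
    has-hole : ∃[ x ] hole x ≡ true
    -- boundary components are disjoint simple cycles: darts on boundary
    -- cycles leave pairwise distinct vertices
    hole-simple : ∀ d d' → hole (face d) ≡ true → hole (face d') ≡ true →
                  tail d ≡ tail d' → d ≡ d'

data Part : Set where
  inT inL inF : Part

record TreeCoforest (M : Map) : Set where
  open MapOps M
  field
    part : Fin m → Part
    T-span    : ∀ v w → ∃[ ds ] (Walk tail head v w ds × All (λ d → part (proj₁ d) ≡ inT) ds)
    T-acyclic : AcyclicG (λ e → part e ≡ inT)
    -- F* is a spanning forest of G*, each component containing exactly one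
    -- dual boundary vertex
    F-acyclic : AcyclicG* (λ e → part e ≡ inF)
    F-reach   : ∀ x → ∃[ h ] (hole h ≡ true × ∃[ ds ] (Walk dtail dhead x h ds ×
                                All (λ d → part (proj₁ d) ≡ inF) ds))
    F-sep     : ∀ h h' ds → hole h ≡ true → hole h' ≡ true →
                Walk dtail dhead h h' ds → All (λ d → part (proj₁ d) ≡ inF) ds → h ≡ h'
    β   : ℕ
    ℓ   : Fin β → Fin m
    ℓ-inj : ∀ i j → ℓ i ≡ ℓ j → i ≡ j
    ℓ-L   : ∀ i → part (ℓ i) ≡ inL
    L-ℓ   : ∀ e → part e ≡ inL → ∃[ i ] ℓ i ≡ e

occ : ∀ {m} → Fin m → List (Dart m) → ℕ
occ e ds = length (filter (λ d → proj₁ d ≟ e) ds)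

record DualArcs (M : Map) (D : TreeCoforest M) : Set where
  open MapOps M
  open TreeCoforest D
  field
    α : Fin β → List (Dart m)
    α-walk : ∀ i → ∃[ r ] ∃[ r' ] (hole r ≡ true × hole r' ≡ true × Walk dtail dhead r r' (α i))
    α-in   : ∀ i → All (λ d → part (proj₁ d) ≡ inF ⊎ proj₁ d ≡ ℓ i) (α i)
    α-once : ∀ i → occ (ℓ i) (α i) ≡ 1

  sigE : Fin m → Vec Bool β
  sigE e = tabulate (λ i → oddℕ (occ e (α i)))

  sig : (Fin m → Bool) → Vec Bool β
  sig H = ⊕-sum (λ e → if H e then sigE e else replicate β false)

-- Write Z = H ⊕ H′; the i-th bit of [Z] is the Z₂-sum of Z along the dual arc αᵢ.
-- If Z = ∂S with S vanishing on the dual boundary vertices, this sum telescopes to the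
-- values of S at the two boundary ends of αᵢ, so it vanishes. Conversely, suppose all
-- these sums vanish and let S(x) be the sum of Z along the path in the forest F* from x
-- to its dual boundary vertex; acyclicity of F* makes this independent of the path.
-- Then Z agrees with ∂S on F-edges by construction and on each L-edge eᵢ because αᵢ is
-- balanced. So Z ⊕ ∂S is an even subgraph contained in the spanning tree T, hence empty.

module Submission where

open import Defs
open import Algebra.Bundles using (CommutativeRing)
open import Data.Bool using (Bool; true; false; not; _xor_; _∧_; if_then_else_)
import Data.Bool as Bool
open import Data.Bool.Properties
  using (xor-same; xor-comm; xor-identityʳ; ∧-zeroʳ; ∧-identityʳ; ∧-distribˡ-xor; ∧-distribʳ-xor;
         not-¬; xor-∧-commutativeRing)
open import Data.Bool.Solver using (module xor-∧-Solver)
open import Data.Empty using (⊥; ⊥-elim)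
open import Data.Fin using (Fin; zero; suc; _≟_)
open import Data.List using (List; []; _∷_; _++_; map; length)
open import Data.List.Properties using (length-++)
open import Data.List.Membership.Propositional using (find)
open import Data.List.Membership.Propositional.Properties using (∈-∃++)
open import Data.List.Relation.Unary.All as All using (All; []; _∷_)
open import Data.List.Relation.Unary.All.Properties using (++⁺; ++⁻ˡ; ++⁻ʳ; map⁺; ¬Any⇒All¬)
open import Data.List.Relation.Unary.AllPairs using ([]; _∷_)
open import Data.List.Relation.Unary.Any using (any?)
open import Data.List.Relation.Unary.Unique.Propositional using (Unique)
open import Data.Nat using (ℕ; zero; suc; _+_; _<_; s≤s; z≤n)
open import Data.Nat.Induction using (<-wellFounded)
open import Data.Nat.Properties
  using (suc-injective; +-comm; ≤-trans; <-trans; n<1+n; n≤1+n; m≤n+m; m<m+n; +-monoʳ-<)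
open import Data.Product using (Σ; _×_; _,_; proj₁; proj₂; ∃-syntax)
open import Data.Product.Properties using (,-injectiveˡ; ,-injectiveʳ)
import Data.Product.Properties as Product
open import Data.Sum using (_⊎_; inj₁; inj₂)
open import Data.Vec using (Vec; lookup; tabulate; replicate)
open import Data.Vec.Properties
  using (lookup-zipWith; lookup-replicate; lookup∘tabulate; tabulate∘lookup; tabulate-cong)
open import Function using (_∘_; _⇔_; mk⇔; Equivalence)
open import Induction.WellFounded using (Acc; acc)
open import Relation.Binary.Definitions using (DecidableEquality)
open import Relation.Binary.PropositionalEquality
open import Relation.Nullary using (Dec; ¬_; yes; no; contradiction)
open import Relation.Nullary.Decidable using (⌊_⌋; isYes≗does; does-⇔; dec-false; ⌊⌋-map′)
open import Algebra.Properties.Group (CommutativeRing.+-group xor-∧-commutativeRing)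
  using (x∙y⁻¹≈ε⇒x≈y; x≈y⇒x∙y⁻¹≈ε)
open xor-∧-Solver using (solve; _:=_; _:+_; _:*_; con)
open ≡-Reasoning

xor≡false⇒≡ : ∀ {a b} → a xor b ≡ false → a ≡ b
xor≡false⇒≡ = x∙y⁻¹≈ε⇒x≈y _ _

xor-transpose : ∀ {a x b} → a ≡ x xor b → x ≡ a xor b
xor-transpose {a} {x} {b} a≡x⊕b = begin
  x                  ≡⟨ solve 2 (λ x b → x := (x :+ b) :+ b) refl x b ⟩
  (x xor b) xor b    ≡⟨ cong (_xor b) (sym a≡x⊕b) ⟩
  a xor b            ∎

≡⇒xor≡false : ∀ {a b} → a ≡ b → a xor b ≡ false
≡⇒xor≡false = x≈y⇒x∙y⁻¹≈ε

xor-telescope : ∀ a b c → (a xor b) xor (b xor c) ≡ a xor c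
xor-telescope = solve 3 (λ a b c → (a :+ b) :+ (b :+ c) := a :+ c) refl

xor-interchange : ∀ a b c d → (a xor b) xor (c xor d) ≡ (a xor c) xor (b xor d)
xor-interchange = solve 4 (λ a b c d → (a :+ b) :+ (c :+ d) := (a :+ c) :+ (b :+ d)) refl

⌊⌋-⇔ : ∀ {P Q : Set} → P ⇔ Q → (p? : Dec P) (q? : Dec Q) → ⌊ p? ⌋ ≡ ⌊ q? ⌋
⌊⌋-⇔ P⇔Q p? q? = trans (isYes≗does p?) (trans (does-⇔ P⇔Q p? q?) (sym (isYes≗does q?)))

⌊⌋-false : ∀ {P : Set} (p? : Dec P) → ¬ P → ⌊ p? ⌋ ≡ false
⌊⌋-false p? ¬p = trans (isYes≗does p?) (dec-false p? ¬p)

parity-cong : ∀ {k} {f g : Fin k → Bool} → (∀ i → f i ≡ g i) → parity f ≡ parity g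
parity-cong {zero}  f≗g = refl
parity-cong {suc k} f≗g = cong₂ _xor_ (f≗g zero) (parity-cong (f≗g ∘ suc))

parity-false : ∀ k → parity {k} (λ _ → false) ≡ false
parity-false zero    = refl
parity-false (suc k) = parity-false k

parity-distrib-xor : ∀ {k} (f g : Fin k → Bool) →
                     parity (λ i → f i xor g i) ≡ parity f xor parity g
parity-distrib-xor {zero}  f g = refl
parity-distrib-xor {suc k} f g =
  trans (cong ((f zero xor g zero) xor_) (parity-distrib-xor (f ∘ suc) (g ∘ suc)))
        (xor-interchange (f zero) (g zero) _ _)

∧-distribˡ-parity : ∀ {k} b (f : Fin k → Bool) → parity (λ i → b ∧ f i) ≡ b ∧ parity f
∧-distribˡ-parity true  f = refl
∧-distribˡ-parity {k} false f = parity-false k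

parity-comm : ∀ {k l} (f : Fin k → Fin l → Bool) →
              parity (λ i → parity (f i)) ≡ parity (λ j → parity (λ i → f i j))
parity-comm {zero} {l} f = sym (parity-false l)
parity-comm {suc k} f =
  trans (cong (parity (f zero) xor_) (parity-comm (f ∘ suc)))
        (sym (parity-distrib-xor (f zero) _))

parity-∧-comm : ∀ {k l} (f : Fin k → Bool) (g : Fin l → Bool) (R : Fin k → Fin l → Bool) →
                parity (λ i → f i ∧ parity (λ j → g j ∧ R i j)) ≡
                parity (λ j → g j ∧ parity (λ i → f i ∧ R i j))
parity-∧-comm f g R = begin
  parity (λ i → f i ∧ parity (λ j → g j ∧ R i j))
    ≡⟨ parity-cong (λ i → sym (∧-distribˡ-parity (f i) (λ j → g j ∧ R i j))) ⟩
  parity (λ i → parity (λ j → f i ∧ (g j ∧ R i j)))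
    ≡⟨ parity-comm (λ i j → f i ∧ (g j ∧ R i j)) ⟩
  parity (λ j → parity (λ i → f i ∧ (g j ∧ R i j)))
    ≡⟨ parity-cong (λ j → parity-cong (λ i → ∧-swap (f i) (g j) (R i j))) ⟩
  parity (λ j → parity (λ i → g j ∧ (f i ∧ R i j)))
    ≡⟨ parity-cong (λ j → ∧-distribˡ-parity (g j) (λ i → f i ∧ R i j)) ⟩
  parity (λ j → g j ∧ parity (λ i → f i ∧ R i j)) ∎
  where
  ∧-swap : ∀ a b c → a ∧ (b ∧ c) ≡ b ∧ (a ∧ c)
  ∧-swap = solve 3 (λ a b c → a :* (b :* c) := b :* (a :* c)) refl

parity-δ : ∀ {k} (g : Fin k → Bool) (a : Fin k) → parity (λ j → g j ∧ (a == j)) ≡ g a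
parity-δ {suc k} g zero = begin
  (g zero ∧ true) xor parity (λ j → g (suc j) ∧ false)
    ≡⟨ cong₂ _xor_ (∧-identityʳ (g zero))
                   (trans (parity-cong (λ j → ∧-zeroʳ (g (suc j)))) (parity-false k)) ⟩
  g zero xor false
    ≡⟨ xor-identityʳ (g zero) ⟩
  g zero ∎
parity-δ g (suc a) = begin
  (g zero ∧ false) xor parity (λ j → g (suc j) ∧ (suc a == suc j))
    ≡⟨ cong₂ _xor_ (∧-zeroʳ (g zero))
                   (parity-cong (λ j → cong (g (suc j) ∧_) (⌊⌋-map′ _ _ (a ≟ j)))) ⟩
  parity (λ j → g (suc j) ∧ (a == j))
    ≡⟨ parity-δ (g ∘ suc) a ⟩
  g (suc a) ∎

parity-δ₂ : ∀ {k} (g : Fin k → Bool) (a b : Fin k) →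
            parity (λ j → g j ∧ ((a == j) xor (b == j))) ≡ g a xor g b
parity-δ₂ g a b = begin
  parity (λ j → g j ∧ ((a == j) xor (b == j)))
    ≡⟨ parity-cong (λ j → ∧-distribˡ-xor (g j) _ _) ⟩
  parity (λ j → (g j ∧ (a == j)) xor (g j ∧ (b == j)))
    ≡⟨ parity-distrib-xor (λ j → g j ∧ (a == j)) (λ j → g j ∧ (b == j)) ⟩
  parity (λ j → g j ∧ (a == j)) xor parity (λ j → g j ∧ (b == j))
    ≡⟨ cong₂ _xor_ (parity-δ g a) (parity-δ g b) ⟩
  g a xor g b ∎

lookup-⊕-sum : ∀ {k β} (v : Fin k → Vec Bool β) i → lookup (⊕-sum v) i ≡ parity (λ e → lookup (v e) i)
lookup-⊕-sum {zero}  v i = lookup-replicate i false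
lookup-⊕-sum {suc k} v i =
  trans (lookup-zipWith _xor_ i (v zero) _) (cong (lookup (v zero) i xor_) (lookup-⊕-sum (v ∘ suc) i))

module _ {m : ℕ} where

  parityᴰ : (Dart m → Bool) → Bool
  parityᴰ g = parity (λ e → g (e , true) xor g (e , false))

  parityᴰ-cong : ∀ {f g : Dart m → Bool} → (∀ d → f d ≡ g d) → parityᴰ f ≡ parityᴰ g
  parityᴰ-cong f≗g = parity-cong (λ e → cong₂ _xor_ (f≗g (e , true)) (f≗g (e , false)))

  parityᴰ-distrib-xor : ∀ (f g : Dart m → Bool) →
                        parityᴰ (λ d → f d xor g d) ≡ parityᴰ f xor parityᴰ g
  parityᴰ-distrib-xor f g =
    trans (parity-cong (λ e → xor-interchange (f (e , true)) (g (e , true)) (f (e , false)) (g (e , false))))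
          (parity-distrib-xor (λ e → f (e , true) xor f (e , false)) (λ e → g (e , true) xor g (e , false)))

  ∧-distribˡ-parityᴰ : ∀ b (f : Dart m → Bool) → parityᴰ (λ d → b ∧ f d) ≡ b ∧ parityᴰ f
  ∧-distribˡ-parityᴰ b f =
    trans (parity-cong (λ e → sym (∧-distribˡ-xor b (f (e , true)) (f (e , false)))))
          (∧-distribˡ-parity b (λ e → f (e , true) xor f (e , false)))

  parityᴰ-comm : ∀ (f : Dart m → Dart m → Bool) →
                 parityᴰ (λ d → parityᴰ (f d)) ≡ parityᴰ (λ d′ → parityᴰ (λ d → f d d′))
  parityᴰ-comm f = begin
    parity (λ e → parityᴰ (f (e , true)) xor parityᴰ (f (e , false)))
      ≡⟨ parity-cong (λ e → sym (parityᴰ-distrib-xor (f (e , true)) (f (e , false)))) ⟩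
    parity (λ e → parity (λ e′ → summand e e′))
      ≡⟨ parity-comm summand ⟩
    parity (λ e′ → parity (λ e → summand e e′))
      ≡⟨ parity-cong (λ e′ → parity-distrib-xor (λ e → f (e , true) (e′ , true) xor f (e , false) (e′ , true))
                                 (λ e → f (e , true) (e′ , false) xor f (e , false) (e′ , false))) ⟩
    parityᴰ (λ d′ → parityᴰ (λ d → f d d′)) ∎
    where
    summand : Fin m → Fin m → Bool
    summand e e′ = (f (e , true) (e′ , true) xor f (e , false) (e′ , true))
               xor (f (e , true) (e′ , false) xor f (e , false) (e′ , false))

  _≟ᴰ_ : DecidableEquality (Dart m)
  _≟ᴰ_ = Product.≡-dec _≟_ Bool._≟_

  _==ᴰ_ : Dart m → Dart m → Bool
  d ==ᴰ d′ = ⌊ d ≟ᴰ d′ ⌋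

  parityᴰ-δ : ∀ (g : Dart m → Bool) a → parityᴰ (λ d → g d ∧ (a ==ᴰ d)) ≡ g a
  parityᴰ-δ g (e₀ , b) = trans (parity-cong (summand b)) (parity-δ (λ e → g (e , b)) e₀)
    where
    same-side : ∀ e b → ((e₀ , b) ==ᴰ (e , b)) ≡ (e₀ == e)
    same-side e b = ⌊⌋-⇔ (mk⇔ ,-injectiveˡ (cong (_, b))) _ _
    other-side : ∀ e b → ((e₀ , b) ==ᴰ (e , not b)) ≡ false
    other-side e b = ⌊⌋-false _ (not-¬ refl ∘ ,-injectiveʳ)
    summand : ∀ b e → (g (e , true) ∧ ((e₀ , b) ==ᴰ (e , true))) xor
                      (g (e , false) ∧ ((e₀ , b) ==ᴰ (e , false)))
                    ≡ g (e , b) ∧ (e₀ == e)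
    summand true e rewrite same-side e true | other-side e true | ∧-zeroʳ (g (e , false)) =
      xor-identityʳ _
    summand false e rewrite same-side e false | other-side e false | ∧-zeroʳ (g (e , true)) = refl

  parityᴰ-permute : ∀ (π π⁻¹ : Dart m → Dart m) → (∀ d → π⁻¹ (π d) ≡ d) → (∀ d → π (π⁻¹ d) ≡ d) →
                    ∀ g → parityᴰ (g ∘ π) ≡ parityᴰ g
  parityᴰ-permute π π⁻¹ inverseˡ inverseʳ g = begin
    parityᴰ (g ∘ π)
      ≡⟨ parityᴰ-cong (λ d → sym (parityᴰ-δ g (π d))) ⟩
    parityᴰ (λ d → parityᴰ (λ d′ → g d′ ∧ (π d ==ᴰ d′)))
      ≡⟨ parityᴰ-comm (λ d d′ → g d′ ∧ (π d ==ᴰ d′)) ⟩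
    parityᴰ (λ d′ → parityᴰ (λ d → g d′ ∧ (π d ==ᴰ d′)))
      ≡⟨ parityᴰ-cong (λ d′ → ∧-distribˡ-parityᴰ (g d′) (λ d → π d ==ᴰ d′)) ⟩
    parityᴰ (λ d′ → g d′ ∧ parityᴰ (λ d → π d ==ᴰ d′))
      ≡⟨ parityᴰ-cong (λ d′ → cong (g d′ ∧_) (one-preimage d′)) ⟩
    parityᴰ (λ d′ → g d′ ∧ true)
      ≡⟨ parityᴰ-cong (λ d′ → ∧-identityʳ (g d′)) ⟩
    parityᴰ g ∎
    where
    one-preimage : ∀ d′ → parityᴰ (λ d → π d ==ᴰ d′) ≡ true
    one-preimage d′ = trans (parityᴰ-cong (λ d → ⌊⌋-⇔ (mk⇔ to from) (π d ≟ᴰ d′) (π⁻¹ d′ ≟ᴰ d)))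
                            (parityᴰ-δ (λ _ → true) (π⁻¹ d′))
      where
      to : ∀ {d} → π d ≡ d′ → π⁻¹ d′ ≡ d
      to {d} refl = inverseˡ d
      from : ∀ {d} → π⁻¹ d′ ≡ d → π d ≡ d′
      from refl = inverseʳ d′

module _ {A : Set} (f : A → A) where

  iter-+ : ∀ j k x → iter f (j + k) x ≡ iter f j (iter f k x)
  iter-+ zero    k x = refl
  iter-+ (suc j) k x = cong f (iter-+ j k x)

  iter-comm : ∀ j k x → iter f j (iter f k x) ≡ iter f k (iter f j x)
  iter-comm j k x = begin
    iter f j (iter f k x) ≡⟨ sym (iter-+ j k x) ⟩
    iter f (j + k) x      ≡⟨ cong (λ i → iter f i x) (+-comm j k) ⟩
    iter f (k + j) x      ≡⟨ iter-+ k j x ⟩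
    iter f k (iter f j x) ∎

  module Recurrent (recurs : ∀ x → ∃[ k ] iter f k (f x) ≡ x) where

    f⁻¹ : A → A
    f⁻¹ x = iter f (proj₁ (recurs x)) x

    inverseʳ : ∀ x → f (f⁻¹ x) ≡ x
    inverseʳ x = trans (iter-comm 1 (proj₁ (recurs x)) x) (proj₂ (recurs x))

    inverseˡ : ∀ x → f⁻¹ (f x) ≡ x
    inverseˡ x = begin
      iter f k′ (f x)                  ≡⟨ cong (iter f k′ ∘ f) (sym (proj₂ (recurs x))) ⟩
      iter f k′ (f (iter f k (f x)))   ≡⟨ cong (iter f k′) (iter-comm 1 k (f x)) ⟩
      iter f k′ (iter f k (f (f x)))   ≡⟨ iter-comm k′ k _ ⟩
      iter f k (iter f k′ (f (f x)))   ≡⟨ cong (iter f k) (proj₂ (recurs (f x))) ⟩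
      iter f k (f x)                   ≡⟨ proj₂ (recurs x) ⟩
      x                                ∎
      where
      k  = proj₁ (recurs x)
      k′ = proj₁ (recurs (f x))

module _ {A B : Set} (_≟ᴮ_ : DecidableEquality B) (key : A → B) where

  data UniqueOrRepeated : List A → Set where
    unique   : ∀ {xs} → Unique (map key xs) → UniqueOrRepeated xs
    repeated : ∀ xs x ys y zs → key x ≡ key y → UniqueOrRepeated (xs ++ x ∷ ys ++ y ∷ zs)

  uniqueOrRepeated : ∀ xs → UniqueOrRepeated xs
  uniqueOrRepeated [] = unique []
  uniqueOrRepeated (x ∷ xs) with any? (λ y → key x ≟ᴮ key y) xs
  ... | yes hit =
    let y , y∈xs , same = find hit
        ys , zs , xs≡ = ∈-∃++ y∈xs
    in subst (UniqueOrRepeated ∘ (x ∷_)) (sym xs≡) (repeated [] x ys y zs same)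
  ... | no miss with uniqueOrRepeated xs
  ...   | unique u                  = unique (map⁺ (¬Any⇒All¬ xs miss) ∷ u)
  ...   | repeated ws y ys z zs same = repeated (x ∷ ws) y ys z zs same

length-++-∷-++-∷ : ∀ {A : Set} xs (x : A) ys y zs →
                   length (xs ++ x ∷ ys ++ y ∷ zs) ≡ length xs + suc (length ys + suc (length zs))
length-++-∷-++-∷ xs x ys y zs =
  trans (length-++ xs) (cong (λ n → length xs + suc n) (length-++ ys))

module _ {A : Set} (xs : List A) (x : A) (ys : List A) (y : A) (zs : List A) where

  length-drop-loop : length (xs ++ x ∷ zs) < length (xs ++ x ∷ ys ++ y ∷ zs)
  length-drop-loop rewrite length-++-∷-++-∷ xs x ys y zs | length-++ xs {x ∷ zs} =
    +-monoʳ-< (length xs) (s≤s (m≤n+m (suc (length zs)) (length ys)))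

  length-loop : length (x ∷ ys) < length (xs ++ x ∷ ys ++ y ∷ zs)
  length-loop rewrite length-++-∷-++-∷ xs x ys y zs =
    ≤-trans (s≤s (m<m+n (length ys) (s≤s z≤n))) (m≤n+m _ (length xs))

  length-drop-both : length (xs ++ zs) < length (xs ++ x ∷ ys ++ y ∷ zs)
  length-drop-both rewrite length-++-∷-++-∷ xs x ys y zs | length-++ xs {zs} =
    +-monoʳ-< (length xs) (s≤s (≤-trans (n≤1+n (length zs)) (m≤n+m _ (length ys))))

  length-between : length ys < length (xs ++ x ∷ ys ++ y ∷ zs)
  length-between = <-trans (n<1+n _) length-loop

module _ {D V : Set} {s t : D → V} where

  walk-++ : ∀ {a b c xs ys} → Walk s t a b xs → Walk s t b c ys → Walk s t a c (xs ++ ys)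
  walk-++ []         w′ = w′
  walk-++ (step d w) w′ = step d (walk-++ w w′)

  walk-split : ∀ xs {a b y ys} → Walk s t a b (xs ++ y ∷ ys) → Walk s t a (s y) xs × Walk s t (t y) b ys
  walk-split []       (step _ w) = [] , w
  walk-split (x ∷ xs) (step _ w) = let w₁ , w₂ = walk-split xs w in step x w₁ , w₂

module _ {m : ℕ} where

  rev-involutive : ∀ (d : Dart m) → rev (rev d) ≡ d
  rev-involutive (e , true)  = refl
  rev-involutive (e , false) = refl

  same-edge : ∀ (x y : Dart m) → proj₁ x ≡ proj₁ y → y ≡ x ⊎ y ≡ rev x
  same-edge (e , true)  (.e , true)  refl = inj₁ refl
  same-edge (e , false) (.e , false) refl = inj₁ refl
  same-edge (e , true)  (.e , false) refl = inj₂ refl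
  same-edge (e , false) (.e , true)  refl = inj₂ refl

  reverseWalk : List (Dart m) → List (Dart m)
  reverseWalk []       = []
  reverseWalk (d ∷ ds) = reverseWalk ds ++ rev d ∷ []

  All-reverseWalk : ∀ {P : Fin m → Set} ds → All (P ∘ proj₁) ds → All (P ∘ proj₁) (reverseWalk ds)
  All-reverseWalk []       []       = []
  All-reverseWalk (d ∷ ds) (p ∷ ps) = ++⁺ (All-reverseWalk ds ps) (p ∷ [])

  walkSum : (Fin m → Bool) → List (Dart m) → Bool
  walkSum c []       = false
  walkSum c (d ∷ ds) = c (proj₁ d) xor walkSum c ds

  walkSum-++ : ∀ c xs ys → walkSum c (xs ++ ys) ≡ walkSum c xs xor walkSum c ys
  walkSum-++ c []       ys = refl
  walkSum-++ c (x ∷ xs) ys =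
    trans (cong (c (proj₁ x) xor_) (walkSum-++ c xs ys))
          (solve 3 (λ a b c → a :+ (b :+ c) := (a :+ b) :+ c) refl (c (proj₁ x)) _ _)

  walkSum-reverseWalk : ∀ c ds → walkSum c (reverseWalk ds) ≡ walkSum c ds
  walkSum-reverseWalk c []       = refl
  walkSum-reverseWalk c (d ∷ ds) = begin
    walkSum c (reverseWalk ds ++ rev d ∷ [])
      ≡⟨ walkSum-++ c (reverseWalk ds) (rev d ∷ []) ⟩
    walkSum c (reverseWalk ds) xor (c (proj₁ d) xor false)
      ≡⟨ cong₂ _xor_ (walkSum-reverseWalk c ds) (xor-identityʳ _) ⟩
    walkSum c ds xor c (proj₁ d)
      ≡⟨ xor-comm (walkSum c ds) (c (proj₁ d)) ⟩
    walkSum c (d ∷ ds) ∎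

  walkSum-cong : ∀ {c c′} → (∀ e → c e ≡ c′ e) → ∀ ds → walkSum c ds ≡ walkSum c′ ds
  walkSum-cong c≗c′ []       = refl
  walkSum-cong c≗c′ (d ∷ ds) = cong₂ _xor_ (c≗c′ (proj₁ d)) (walkSum-cong c≗c′ ds)

  walkSum-xor : ∀ c c′ ds → walkSum (λ e → c e xor c′ e) ds ≡ walkSum c ds xor walkSum c′ ds
  walkSum-xor c c′ []       = refl
  walkSum-xor c c′ (d ∷ ds) =
    trans (cong ((c (proj₁ d) xor c′ (proj₁ d)) xor_) (walkSum-xor c c′ ds))
          (xor-interchange (c (proj₁ d)) _ _ _)

  walkSum-repeated : ∀ c xs x ys zs →
                     walkSum c (xs ++ x ∷ ys ++ x ∷ zs) ≡ walkSum c (xs ++ x ∷ zs) xor walkSum c (x ∷ ys)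
  walkSum-repeated c xs x ys zs = begin
    walkSum c (xs ++ x ∷ ys ++ x ∷ zs)
      ≡⟨ walkSum-++ c xs _ ⟩
    walkSum c xs xor (c (proj₁ x) xor walkSum c (ys ++ x ∷ zs))
      ≡⟨ cong (λ w → walkSum c xs xor (c (proj₁ x) xor w)) (walkSum-++ c ys _) ⟩
    walkSum c xs xor (c (proj₁ x) xor (walkSum c ys xor (c (proj₁ x) xor walkSum c zs)))
      ≡⟨ solve 4 (λ a x b z → a :+ (x :+ (b :+ (x :+ z))) := (a :+ (x :+ z)) :+ (x :+ b))
               refl (walkSum c xs) (c (proj₁ x)) (walkSum c ys) (walkSum c zs) ⟩
    (walkSum c xs xor (c (proj₁ x) xor walkSum c zs)) xor walkSum c (x ∷ ys)
      ≡⟨ cong (_xor walkSum c (x ∷ ys)) (sym (walkSum-++ c xs _)) ⟩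
    walkSum c (xs ++ x ∷ zs) xor walkSum c (x ∷ ys) ∎

  walkSum-reversed : ∀ c xs x ys zs →
                     walkSum c (xs ++ x ∷ ys ++ rev x ∷ zs) ≡ walkSum c (xs ++ zs) xor walkSum c ys
  walkSum-reversed c xs x ys zs = begin
    walkSum c (xs ++ x ∷ ys ++ rev x ∷ zs)
      ≡⟨ walkSum-++ c xs _ ⟩
    walkSum c xs xor (c (proj₁ x) xor walkSum c (ys ++ rev x ∷ zs))
      ≡⟨ cong (λ w → walkSum c xs xor (c (proj₁ x) xor w)) (walkSum-++ c ys _) ⟩
    walkSum c xs xor (c (proj₁ x) xor (walkSum c ys xor (c (proj₁ x) xor walkSum c zs)))
      ≡⟨ solve 4 (λ a x b z → a :+ (x :+ (b :+ (x :+ z))) := (a :+ z) :+ b)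
               refl (walkSum c xs) (c (proj₁ x)) (walkSum c ys) (walkSum c zs) ⟩
    (walkSum c xs xor walkSum c zs) xor walkSum c ys
      ≡⟨ cong (_xor walkSum c ys) (sym (walkSum-++ c xs zs)) ⟩
    walkSum c (xs ++ zs) xor walkSum c ys ∎

  oddℕ-occ-∷ : ∀ (e : Fin m) d ds → oddℕ (occ e (d ∷ ds)) ≡ (proj₁ d == e) xor oddℕ (occ e ds)
  oddℕ-occ-∷ e d ds with proj₁ d ≟ e
  ... | yes _ = refl
  ... | no  _ = refl

  walkSum-occ : ∀ c ds → walkSum c ds ≡ parity (λ e → c e ∧ oddℕ (occ e ds))
  walkSum-occ c []       = sym (trans (parity-cong (λ e → ∧-zeroʳ (c e))) (parity-false m))
  walkSum-occ c (d ∷ ds) = sym (begin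
    parity (λ e → c e ∧ oddℕ (occ e (d ∷ ds)))
      ≡⟨ parity-cong (λ e → trans (cong (c e ∧_) (oddℕ-occ-∷ e d ds)) (∧-distribˡ-xor (c e) _ _)) ⟩
    parity (λ e → (c e ∧ (proj₁ d == e)) xor (c e ∧ oddℕ (occ e ds)))
      ≡⟨ parity-distrib-xor (λ e → c e ∧ (proj₁ d == e)) (λ e → c e ∧ oddℕ (occ e ds)) ⟩
    parity (λ e → c e ∧ (proj₁ d == e)) xor parity (λ e → c e ∧ oddℕ (occ e ds))
      ≡⟨ cong₂ _xor_ (parity-δ c (proj₁ d)) (sym (walkSum-occ c ds)) ⟩
    walkSum c (d ∷ ds) ∎)

  occ-zero : ∀ (e : Fin m) ds → occ e ds ≡ 0 → All (λ d → proj₁ d ≢ e) ds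
  occ-zero e []       _ = []
  occ-zero e (d ∷ ds) o with proj₁ d ≟ e
  occ-zero e (d ∷ ds) () | yes _
  occ-zero e (d ∷ ds) o  | no d≢e = d≢e ∷ occ-zero e ds o

  occ-one-split : ∀ (e : Fin m) ds → occ e ds ≡ 1 →
                  Σ (List (Dart m)) λ xs → Σ (Dart m) λ d → Σ (List (Dart m)) λ ys →
                    ds ≡ xs ++ d ∷ ys × proj₁ d ≡ e ×
                    All (λ d → proj₁ d ≢ e) xs × All (λ d → proj₁ d ≢ e) ys
  occ-one-split e (d ∷ ds) o with proj₁ d ≟ e
  ... | yes d≡e = [] , d , ds , refl , d≡e , [] , occ-zero e ds (suc-injective o)
  ... | no  d≢e =
    let xs , d′ , ys , split , d′≡e , xs∌e , ys∌e = occ-one-split e ds o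
    in d ∷ xs , d′ , ys , cong (d ∷_) split , d′≡e , d≢e ∷ xs∌e , ys∌e

module ClosedWalks {m : ℕ} {V : Set} (s : Dart m → V) where

  walk-reverse : ∀ {a b ds} → Walk s (s ∘ rev) a b ds → Walk s (s ∘ rev) b a (reverseWalk ds)
  walk-reverse []         = []
  walk-reverse (step d w) =
    walk-++ (walk-reverse w)
            (subst (λ v → Walk s (s ∘ rev) (s (rev d)) v (rev d ∷ [])) (cong s (rev-involutive d))
                   (step (rev d) []))

  Acyclic : (Fin m → Set) → Set
  Acyclic P = ∀ v ds → Walk s (s ∘ rev) v v ds → ds ≢ [] →
              All (λ d → P (proj₁ d)) ds → Unique (map proj₁ ds) → ⊥

  ClosedWalkIn : (Fin m → Set) → List (Dart m) → Set
  ClosedWalkIn P ds = (∃[ v ] Walk s (s ∘ rev) v v ds) × All (P ∘ proj₁) ds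

  module _ {P : Fin m → Set} where

    split-repeated : ∀ xs x ys zs → ClosedWalkIn P (xs ++ x ∷ ys ++ x ∷ zs) →
                     ClosedWalkIn P (xs ++ x ∷ zs) × ClosedWalkIn P (x ∷ ys)
    split-repeated xs x ys zs ((v , w) , ps) =
      let wxs , w′ = walk-split xs w
          wys , wzs = walk-split ys w′
          pxs = ++⁻ˡ xs ps
          px , ps′ = All.uncons (++⁻ʳ xs ps)
          pys = ++⁻ˡ ys ps′
          pzs = All.tail (++⁻ʳ ys ps′)
      in ((v , walk-++ wxs (step x wzs)) , ++⁺ pxs (px ∷ pzs)) , ((s x , step x wys) , px ∷ pys)

    split-reversed : ∀ xs x ys zs → ClosedWalkIn P (xs ++ x ∷ ys ++ rev x ∷ zs) →
                     ClosedWalkIn P (xs ++ zs) × ClosedWalkIn P ys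
    split-reversed xs x ys zs ((v , w) , ps) =
      let wxs , w′ = walk-split xs w
          wys , wzs = walk-split ys w′
          pxs = ++⁻ˡ xs ps
          _ , ps′ = All.uncons (++⁻ʳ xs ps)
          pys = ++⁻ˡ ys ps′
          pzs = All.tail (++⁻ʳ ys ps′)
          wzs′ = subst (λ u → Walk s (s ∘ rev) u v zs) (cong s (rev-involutive x)) wzs
      in ((v , walk-++ wxs wzs′) , ++⁺ pxs pzs) , ((s (rev x) , wys) , pys)

    closedTrail-empty : Acyclic P → ∀ ds → ClosedWalkIn P ds → Unique (map proj₁ ds) → ds ≡ []
    closedTrail-empty acyclic []       _              _ = refl
    closedTrail-empty acyclic (d ∷ ds) ((v , w) , ps) u = ⊥-elim (acyclic v (d ∷ ds) w (λ ()) ps u)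

    -- A closed walk that is not a trail repeats an edge, in the same or the opposite
    -- direction; cutting there yields two shorter closed walks.
    closedWalk-walkSum : Acyclic P → ∀ c ds → ClosedWalkIn P ds → walkSum c ds ≡ false
    closedWalk-walkSum acyclic c ds = go ds (<-wellFounded (length ds))
      where
      go : ∀ ds → Acc _<_ (length ds) → ClosedWalkIn P ds → walkSum c ds ≡ false
      go ds _ closed with uniqueOrRepeated _≟_ proj₁ ds
      go ds _ closed | unique u = cong (walkSum c) (closedTrail-empty acyclic ds closed u)
      go _ (acc shorter) closed | repeated xs x ys y zs same with same-edge x y same
      ... | inj₁ refl =
        let outer , loop = split-repeated xs x ys zs closed
        in begin
          walkSum c (xs ++ x ∷ ys ++ x ∷ zs)
            ≡⟨ walkSum-repeated c xs x ys zs ⟩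
          walkSum c (xs ++ x ∷ zs) xor walkSum c (x ∷ ys)
            ≡⟨ cong₂ _xor_ (go _ (shorter (length-drop-loop xs x ys x zs)) outer)
                           (go _ (shorter (length-loop xs x ys x zs)) loop) ⟩
          false ∎
      ... | inj₂ refl =
        let outer , inner = split-reversed xs x ys zs closed
        in begin
          walkSum c (xs ++ x ∷ ys ++ rev x ∷ zs)
            ≡⟨ walkSum-reversed c xs x ys zs ⟩
          walkSum c (xs ++ zs) xor walkSum c ys
            ≡⟨ cong₂ _xor_ (go _ (shorter (length-drop-both xs x ys (rev x) zs)) outer)
                           (go _ (shorter (length-between xs x ys (rev x) zs)) inner) ⟩
          false ∎

    walkSum-unique : Acyclic P → ∀ c {a b xs ys} →
                     Walk s (s ∘ rev) a b xs → All (P ∘ proj₁) xs →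
                     Walk s (s ∘ rev) a b ys → All (P ∘ proj₁) ys →
                     walkSum c xs ≡ walkSum c ys
    walkSum-unique acyclic c {b = b} {xs} {ys} wxs pxs wys pys = xor≡false⇒≡ (begin
      walkSum c xs xor walkSum c ys
        ≡⟨ cong (_xor walkSum c ys) (sym (walkSum-reverseWalk c xs)) ⟩
      walkSum c (reverseWalk xs) xor walkSum c ys
        ≡⟨ sym (walkSum-++ c (reverseWalk xs) ys) ⟩
      walkSum c (reverseWalk xs ++ ys)
        ≡⟨ closedWalk-walkSum acyclic c _
             ((b , walk-++ (walk-reverse wxs) wys) , ++⁺ (All-reverseWalk xs pxs) pys) ⟩
      false ∎)

module Chains (M : Map) where
  open MapOps M
  open ClosedWalks tail using (walkSum-unique)

  incident : Fin m → Fin n → Bool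
  incident e v = (tail (e , true) == v) xor (tail (e , false) == v)

  ∂sub-edge : ∀ S e → ∂sub S e ≡ S (face (e , true)) xor S (face (e , false))
  ∂sub-edge S e = parity-δ₂ S (face (e , true)) (face (e , false))

  ∂sub-dart : ∀ S d → ∂sub S (proj₁ d) ≡ S (dtail d) xor S (dhead d)
  ∂sub-dart S (e , true)  = ∂sub-edge S e
  ∂sub-dart S (e , false) = trans (∂sub-edge S e) (xor-comm (S (face (e , true))) (S (face (e , false))))

  walkSum-∂sub : ∀ S {x y ds} → Walk dtail dhead x y ds → walkSum (∂sub S) ds ≡ S x xor S y
  walkSum-∂sub S {x} []             = sym (xor-same (S x))
  walkSum-∂sub S {y = y} (step d w) =
    trans (cong₂ _xor_ (∂sub-dart S d) (walkSum-∂sub S w)) (xor-telescope (S (dtail d)) (S (dhead d)) (S y))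

  even-xor : ∀ {c c′} → Even c → Even c′ → Even (λ e → c e xor c′ e)
  even-xor {c} {c′} even-c even-c′ v = begin
    parity (λ e → (c e xor c′ e) ∧ incident e v)
      ≡⟨ parity-cong (λ e → ∧-distribʳ-xor (incident e v) (c e) (c′ e)) ⟩
    parity (λ e → (c e ∧ incident e v) xor (c′ e ∧ incident e v))
      ≡⟨ parity-distrib-xor (λ e → c e ∧ incident e v) (λ e → c′ e ∧ incident e v) ⟩
    parity (λ e → c e ∧ incident e v) xor parity (λ e → c′ e ∧ incident e v)
      ≡⟨ cong₂ _xor_ (even-c v) (even-c′ v) ⟩
    false ∎

  Spanning : (Fin m → Set) → Set
  Spanning P = ∀ v w → ∃[ ds ] (Walk tail head v w ds × All (λ d → P (proj₁ d)) ds)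

  -- side v records whether the tree path from an endpoint of e to v uses e; summing the
  -- degrees of c against side picks out c e alone, since only e separates the two sides.
  even-in-spanningTree-empty : ∀ {P} → AcyclicG P → Spanning P →
                               ∀ c → Even c → (∀ e → c e ≡ true → P e) → ∀ e → c e ≡ false
  even-in-spanningTree-empty {P} acyclic spanning c even c⊆P e = begin
    c e
      ≡⟨ sym (parity-δ c e) ⟩
    parity (λ e′ → c e′ ∧ (e == e′))
      ≡⟨ parity-cong (λ e′ → sym (crossing e′)) ⟩
    parity (λ e′ → c e′ ∧ parity (λ v → side v ∧ incident e′ v))
      ≡⟨ parity-∧-comm c side incident ⟩
    parity (λ v → side v ∧ parity (λ e′ → c e′ ∧ incident e′ v))
      ≡⟨ parity-cong (λ v → trans (cong (side v ∧_) (even v)) (∧-zeroʳ (side v))) ⟩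
    parity {n} (λ _ → false)
      ≡⟨ parity-false n ⟩
    false ∎
    where
    root : Fin n
    root = tail (e , true)
    side : Fin n → Bool
    side v = walkSum (e ==_) (proj₁ (spanning root v))
    cut : ∀ {e′} → P e′ → side (tail (e′ , true)) xor side (tail (e′ , false)) ≡ (e == e′)
    cut {e′} P-e′ =
      let ds₁ , w₁ , p₁ = spanning root (tail (e′ , true))
          ds₂ , w₂ , p₂ = spanning root (tail (e′ , false))
          extended = walkSum-unique acyclic (e ==_)
                       (walk-++ w₁ (step (e′ , true) [])) (++⁺ p₁ (P-e′ ∷ [])) w₂ p₂
      in begin
        side (tail (e′ , true)) xor side (tail (e′ , false))
          ≡⟨ cong (side (tail (e′ , true)) xor_) (sym extended) ⟩
        side (tail (e′ , true)) xor walkSum (e ==_) (ds₁ ++ (e′ , true) ∷ [])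
          ≡⟨ cong (side (tail (e′ , true)) xor_) (walkSum-++ (e ==_) ds₁ ((e′ , true) ∷ [])) ⟩
        side (tail (e′ , true)) xor (side (tail (e′ , true)) xor ((e == e′) xor false))
          ≡⟨ solve 2 (λ a x → a :+ (a :+ (x :+ con false)) := x) refl (side (tail (e′ , true))) (e == e′) ⟩
        (e == e′) ∎
    crossing : ∀ e′ → c e′ ∧ parity (λ v → side v ∧ incident e′ v) ≡ c e′ ∧ (e == e′)
    crossing e′ with c e′ in c-e′
    ... | false = refl
    ... | true  = trans (parity-δ₂ side (tail (e′ , true)) (tail (e′ , false))) (cut (c⊆P e′ c-e′))

module FaceBoundaries (M : Map) (E : IsEmbedded M) where
  open MapOps M
  open IsEmbedded E
  open Chains M
  open Recurrent φ (λ d → face-orb (φ d) d (face-φ d)) renaming (f⁻¹ to φ⁻¹)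

  -- Splitting each edge into its two darts, the degree of ∂S at v counts darts leaving v
  -- and darts entering v; φ maps the latter bijectively onto the former, within the same face.
  ∂sub-even : ∀ S → Even (∂sub S)
  ∂sub-even S v = begin
    parity (λ e → ∂sub S e ∧ incident e v)
      ≡⟨ parity-cong (λ e → trans (cong (_∧ incident e v) (∂sub-edge S e)) (expand e)) ⟩
    parityᴰ (λ d → leaving d xor entering d)
      ≡⟨ parityᴰ-distrib-xor leaving entering ⟩
    parityᴰ leaving xor parityᴰ entering
      ≡⟨ cong (parityᴰ leaving xor_) entering≡leaving ⟩
    parityᴰ leaving xor parityᴰ leaving
      ≡⟨ xor-same (parityᴰ leaving) ⟩
    false ∎
    where
    leaving entering : Dart m → Bool
    leaving  d = S (face d) ∧ (tail d == v)
    entering d = S (face d) ∧ (head d == v)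
    expand : ∀ e → (S (face (e , true)) xor S (face (e , false))) ∧ incident e v ≡
                   (leaving (e , true) xor entering (e , true)) xor (leaving (e , false) xor entering (e , false))
    expand e = solve 4 (λ a b p q → (a :+ b) :* (p :+ q) := ((a :* p) :+ (a :* q)) :+ ((b :* q) :+ (b :* p)))
                 refl (S (face (e , true))) (S (face (e , false))) (tail (e , true) == v) (tail (e , false) == v)
    entering≡leaving : parityᴰ entering ≡ parityᴰ leaving
    entering≡leaving =
      trans (parityᴰ-cong (λ d → sym (cong₂ _∧_ (cong S (face-φ d)) (cong (_== v) (σ-tail (rev d))))))
            (parityᴰ-permute φ φ⁻¹ inverseˡ inverseʳ leaving)

module Potentials {M : Map} (D : TreeCoforest M) where
  open MapOps M
  open TreeCoforest D
  open Chains M using (∂sub-edge; ∂sub-dart)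
  open ClosedWalks dtail using (walk-reverse; walkSum-unique)

  FWalk : List (Dart m) → Set
  FWalk = All (λ d → part (proj₁ d) ≡ inF)

  potential : (Fin m → Bool) → Fin f → Bool
  potential c x = walkSum c (proj₁ (proj₂ (proj₂ (F-reach x))))

  potential-walk : ∀ c {x h ds} → hole h ≡ true → Walk dtail dhead x h ds → FWalk ds →
                   potential c x ≡ walkSum c ds
  potential-walk c {x} {h} h-hole w w-F =
    let h₀ , h₀-hole , ds₀ , w₀ , w₀-F = F-reach x
        h₀≡h = F-sep h₀ h _ h₀-hole h-hole
                 (walk-++ (walk-reverse w₀) w) (++⁺ (All-reverseWalk ds₀ w₀-F) w-F)
    in walkSum-unique F-acyclic c w₀ w₀-F (subst (λ y → Walk dtail dhead x y _) (sym h₀≡h) w) w-F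

  potential-hole : ∀ c {x} → hole x ≡ true → potential c x ≡ false
  potential-hole c x-hole = potential-walk c x-hole [] []

  F-edge-boundary : ∀ c e → part e ≡ inF → c e ≡ ∂sub (potential c) e
  F-edge-boundary c e e-F =
    let _ , h-hole , _ , w , w-F = F-reach (face (e , false))
        across-e = potential-walk c h-hole (step (e , true) w) (e-F ∷ w-F)
    in trans (xor-transpose across-e) (sym (∂sub-edge (potential c) e))

  balanced-crossing : ∀ c {r r′ xs d ys} → hole r ≡ true → hole r′ ≡ true →
                      Walk dtail dhead r r′ (xs ++ d ∷ ys) → FWalk xs → FWalk ys →
                      walkSum c (xs ++ d ∷ ys) ≡ false → c (proj₁ d) ≡ ∂sub (potential c) (proj₁ d)
  balanced-crossing c {xs = xs} {d} {ys} r-hole r′-hole w xs-F ys-F balanced =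
    let w-xs , w-ys = walk-split xs w
    in begin
      c (proj₁ d)
        ≡⟨ xor-transpose {x = c (proj₁ d)} {b = walkSum c ys}
             (xor≡false⇒≡ {walkSum c xs} (trans (sym (walkSum-++ c xs (d ∷ ys))) balanced)) ⟩
      walkSum c xs xor walkSum c ys
        ≡⟨ cong (_xor walkSum c ys) (sym (walkSum-reverseWalk c xs)) ⟩
      walkSum c (reverseWalk xs) xor walkSum c ys
        ≡⟨ sym (cong₂ _xor_ (potential-walk c r-hole (walk-reverse w-xs) (All-reverseWalk xs xs-F))
                            (potential-walk c r′-hole w-ys ys-F)) ⟩
      potential c (dtail d) xor potential c (dhead d)
        ≡⟨ sym (∂sub-dart (potential c) d) ⟩
      ∂sub (potential c) (proj₁ d) ∎

module Signatures {M : Map} {D : TreeCoforest M} (A : DualArcs M D) where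
  open MapOps M
  open TreeCoforest D
  open DualArcs A
  open Chains M using (walkSum-∂sub; even-xor; even-in-spanningTree-empty)
  open Potentials D

  lookup-sig : ∀ H i → lookup (sig H) i ≡ walkSum H (α i)
  lookup-sig H i = begin
    lookup (sig H) i
      ≡⟨ lookup-⊕-sum (λ e → if H e then sigE e else replicate β false) i ⟩
    parity (λ e → lookup (if H e then sigE e else replicate β false) i)
      ≡⟨ parity-cong (λ e → lookup-term (H e) e) ⟩
    parity (λ e → H e ∧ oddℕ (occ e (α i)))
      ≡⟨ sym (walkSum-occ H (α i)) ⟩
    walkSum H (α i) ∎
    where
    lookup-term : ∀ b e → lookup (if b then sigE e else replicate β false) i ≡ b ∧ oddℕ (occ e (α i))
    lookup-term true  e = lookup∘tabulate (λ i → oddℕ (occ e (α i))) i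
    lookup-term false e = lookup-replicate i false

  sig-≡⇔ : ∀ H H′ → sig H ≡ sig H′ ⇔ (∀ i → walkSum (λ e → H e xor H′ e) (α i) ≡ false)
  sig-≡⇔ H H′ = mk⇔ to from
    where
    to : sig H ≡ sig H′ → ∀ i → walkSum (λ e → H e xor H′ e) (α i) ≡ false
    to eq i = trans (walkSum-xor H H′ (α i)) (≡⇒xor≡false (begin
      walkSum H (α i)    ≡⟨ sym (lookup-sig H i) ⟩
      lookup (sig H) i   ≡⟨ cong (λ v → lookup v i) eq ⟩
      lookup (sig H′) i  ≡⟨ lookup-sig H′ i ⟩
      walkSum H′ (α i)   ∎))
    from : (∀ i → walkSum (λ e → H e xor H′ e) (α i) ≡ false) → sig H ≡ sig H′
    from balanced = begin
      sig H                       ≡⟨ sym (tabulate∘lookup (sig H)) ⟩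
      tabulate (lookup (sig H))   ≡⟨ tabulate-cong same-bit ⟩
      tabulate (lookup (sig H′))  ≡⟨ tabulate∘lookup (sig H′) ⟩
      sig H′                      ∎
      where
      same-bit : ∀ i → lookup (sig H) i ≡ lookup (sig H′) i
      same-bit i = begin
        lookup (sig H) i   ≡⟨ lookup-sig H i ⟩
        walkSum H (α i)    ≡⟨ xor≡false⇒≡ (trans (sym (walkSum-xor H H′ (α i))) (balanced i)) ⟩
        walkSum H′ (α i)   ≡⟨ sym (lookup-sig H′ i) ⟩
        lookup (sig H′) i  ∎

  L-edge-boundary : ∀ c i → walkSum c (α i) ≡ false → c (ℓ i) ≡ ∂sub (potential c) (ℓ i)
  L-edge-boundary c i balanced =
    let r , r′ , r-hole , r′-hole , w = α-walk i
        xs , d , ys , α≡ , d≡ℓ , xs∌ℓ , ys∌ℓ = occ-one-split (ℓ i) (α i) (α-once i)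
        α-F⊎ℓ = subst (All (λ d → part (proj₁ d) ≡ inF ⊎ proj₁ d ≡ ℓ i)) α≡ (α-in i)
    in subst (λ e → c e ≡ ∂sub (potential c) e) d≡ℓ
         (balanced-crossing c r-hole r′-hole (subst (Walk dtail dhead r r′) α≡ w)
            (F-only (++⁻ˡ xs α-F⊎ℓ) xs∌ℓ) (F-only (All.tail (++⁻ʳ xs α-F⊎ℓ)) ys∌ℓ)
            (trans (cong (walkSum c) (sym α≡)) balanced))
    where
    F-only : ∀ {ds} → All (λ d → part (proj₁ d) ≡ inF ⊎ proj₁ d ≡ ℓ i) ds →
             All (λ d → proj₁ d ≢ ℓ i) ds → FWalk ds
    F-only F⊎ℓ ∌ℓ = All.zipWith (λ { (inj₁ d-F , _)     → d-F
                                   ; (inj₂ d≡ℓ , d≢ℓ) → ⊥-elim (d≢ℓ d≡ℓ) }) (F⊎ℓ , ∌ℓ)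

  balanced-cycle-boundary : IsEmbedded M → ∀ Z → Even Z → (∀ i → walkSum Z (α i) ≡ false) →
                            ∀ e → Z e ≡ ∂sub (potential Z) e
  balanced-cycle-boundary E Z even-Z balanced e =
    xor≡false⇒≡ (even-in-spanningTree-empty T-acyclic T-span defect
                   (even-xor even-Z (FaceBoundaries.∂sub-even M E (potential Z))) defect⊆T e)
    where
    defect : Fin m → Bool
    defect e = Z e xor ∂sub (potential Z) e
    boundary-off-tree : ∀ e → Z e ≡ ∂sub (potential Z) e ⊎ part e ≡ inT
    boundary-off-tree e with part e in e-part
    ... | inT = inj₂ refl
    ... | inF = inj₁ (F-edge-boundary Z e e-part)
    ... | inL = let i , ℓi≡e = L-ℓ e e-part
                in inj₁ (subst (λ e → Z e ≡ ∂sub (potential Z) e) ℓi≡e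
                               (L-edge-boundary Z i (balanced i)))
    defect⊆T : ∀ e → defect e ≡ true → part e ≡ inT
    defect⊆T e defect≡true with boundary-off-tree e
    ... | inj₂ e-T  = e-T
    ... | inj₁ Z≡∂S = contradiction (trans (sym (≡⇒xor≡false Z≡∂S)) defect≡true) λ ()

  homologous⇒sig-≡ : ∀ H H′ → Homologous H H′ → sig H ≡ sig H′
  homologous⇒sig-≡ H H′ (S , S-holes , H⊕H′≡∂S) = Equivalence.from (sig-≡⇔ H H′) λ i →
    let r , r′ , r-hole , r′-hole , w = α-walk i
    in begin
      walkSum (λ e → H e xor H′ e) (α i)  ≡⟨ walkSum-cong H⊕H′≡∂S (α i) ⟩
      walkSum (∂sub S) (α i)              ≡⟨ walkSum-∂sub S w ⟩
      S r xor S r′                        ≡⟨ cong₂ _xor_ (S-holes r r-hole) (S-holes r′ r′-hole) ⟩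
      false                               ∎

  sig-≡⇒homologous : IsEmbedded M → ∀ H H′ → Even H → Even H′ →
                     sig H ≡ sig H′ → Homologous H H′
  sig-≡⇒homologous E H H′ even-H even-H′ eq =
    potential Z , (λ x → potential-hole Z) ,
    balanced-cycle-boundary E Z (even-xor even-H even-H′) (Equivalence.to (sig-≡⇔ H H′) eq)
    where
    Z : Fin m → Bool
    Z e = H e xor H′ e

corollary3p5 : (M : Map) → IsEmbedded M → (D : TreeCoforest M) (A : DualArcs M D)
               (H H' : Fin (Map.m M) → Bool) →
               MapOps.Even M H → MapOps.Even M H' →
               (MapOps.Homologous M H H' → DualArcs.sig A H ≡ DualArcs.sig A H') ×
               (DualArcs.sig A H ≡ DualArcs.sig A H' → MapOps.Homologous M H H')
corollary3p5 M E D A H H' even-H even-H' =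
  homologous⇒sig-≡ H H' , sig-≡⇒homologous E H H' even-H even-H'
  where open Signatures A
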